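{- Define $f:\mathbb N\to\mathbb N$ by $$f(n)=\begin{cases}\lfloor\varphi n\rfloor+1,& n\in R_{0,0},\\ \lfloor(\varphi-1)n\rfloor,& n\in R_{1,0}.\end{cases}$$ Then $f$ is a permutation (bijection) of $\mathbb N$ of order $2$, i.e. $f\circ f=\mathrm{id}_{\mathbb N}$ and $f\neq\mathrm{id}_{\mathbb N}$.
   Context: Let $\varphi=\frac{1+\sqrt5}{2}$ and $\mathbb N=\{1,2,3,\dots\}$; $a(n)=\lfloor n\varphi\rfloor$. $F$ is the Fibonacci sequence, $F(0)=0$, $F(1)=F(2)=1$, $F(n)=F(n-1)+F(n-2)$. For $i\in\mathbb Z^{\geq0}$, $j\in\mathbb Z$, let $f_{i,j}(n)=F(i+1)a(n)+F(i)n-j$ ($n\in\mathbb N$) and $R_{i,j}=\{f_{i,j}(n)\mid n\in\mathbb N\}$. Thus $R_{0,0}=\{\lfloor n\varphi\rfloor\}$ and $R_{1,0}=\{\lfloor n\varphi^2\rfloor\}$, which partition $\mathbb N$. -}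

module Defs where

open import Data.Bool using (if_then_else_)
open import Data.Nat as ℕ using (ℕ; zero; suc)
open import Data.Integer as ℤ using (ℤ; +_; -_)
import Data.Integer.Properties as ℤP
open import Data.Product using (_×_; ∃-syntax)
open import Data.Sum using (_⊎_)
open import Relation.Nullary.Decidable using (Dec; ⌊_⌋; _⊎-dec_)
open import Relation.Binary.PropositionalEquality using (_≡_)

-- Real numbers of the form x = (p + q·√5)/2 with p ∈ ℤ, q ∈ ℕ are represented
-- by the pair (p , q).  For m ∈ ℕ:
--   m ≤ (p + q√5)/2  ⇔  2m - p ≤ q√5  ⇔  2m - p ≤ 0  or  (2m - p)² ≤ 5q²
-- (exact, since q ≥ 0).
LeSurd : ℤ → ℕ → ℕ → Set
LeSurd p q m =
  (d ℤ.≤ + 0) ⊎ (d ℤ.* d ℤ.≤ + 5 ℤ.* (+ q) ℤ.* (+ q))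
  where d = (+ 2) ℤ.* (+ m) ℤ.- p

leSurd? : (p : ℤ) (q m : ℕ) → Dec (LeSurd p q m)
leSurd? p q m = (d ℤP.≤? + 0) ⊎-dec (d ℤ.* d ℤP.≤? + 5 ℤ.* (+ q) ℤ.* (+ q))
  where d = (+ 2) ℤ.* (+ m) ℤ.- p

-- floorBelow p q B = max { m ≤ B : m ≤ (p + q√5)/2 }  (0 if there is none).
-- This equals ⌊(p + q√5)/2⌋ whenever 0 ≤ (p + q√5)/2 < B + 1.
floorBelow : ℤ → ℕ → ℕ → ℕ
floorBelow p q zero = zero
floorBelow p q (suc B) =
  if ⌊ leSurd? p q (suc B) ⌋ then suc B else floorBelow p q B

-- a(n) = ⌊ n φ ⌋ where n φ = (n + n√5)/2 ∈ [0 , 2n + 1).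
a : ℕ → ℕ
a n = floorBelow (+ n) n (2 ℕ.* n)

-- ⌊ (φ - 1) n ⌋ where (φ - 1) n = (-n + n√5)/2 ∈ [0 , n + 1).
floorPhiMinus1 : ℕ → ℕ
floorPhiMinus1 n = floorBelow (- (+ n)) n n

F : ℕ → ℕ
F zero = 0
F (suc zero) = 1
F (suc (suc n)) = F (suc n) ℕ.+ F n

fij : ℕ → ℤ → ℕ → ℤ
fij i j k = + (F (suc i) ℕ.* a k ℕ.+ F i ℕ.* k) ℤ.- j

R : ℕ → ℤ → ℕ → Set
R i j n = ∃[ k ] (1 ℕ.≤ k × + n ≡ fij i j k)

-- Write Q(x, y) = x² − xy − y².  Since φ² = φ + 1, for naturals x ≤ φy iff
-- Q(x, y) ≤ 0 and φy ≤ x iff Q(x, y) ≥ 0; so a(k) = ⌊φk⌋ is the m with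
-- m ≤ φk < m + 1, and ⌊(φ − 1)n⌋ = ⌊n/φ⌋ is the c with φc ≤ n < φ(c + 1).
-- The identity Q(x + y, x) = −Q(x, y), i.e. x ≤ φy ⇔ φx ≤ x + y, together with
-- the irrationality of φ (Q(x, y) ≠ 0 for y ≥ 1, by descent along the same
-- identity) gives, for m = a(k), a(m) = m + k − 1 and ⌊(m + k)/φ⌋ = m, so f
-- exchanges a(k) and a(k) + k.  Every n ≥ 1 has one of these two forms: with
-- c = ⌊n/φ⌋, n = a(c + 1) if n + 1 > φ(c + 1), and n = a(j) + j with j = n − c
-- otherwise.
module Submission where

open import Defs
open import Data.Nat using (ℕ; _≤_; _+_)
open import Data.Integer using (+_)
open import Data.Product using (_×_; ∃-syntax)
open import Relation.Binary.PropositionalEquality using (_≡_; _≢_)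

open import Data.Nat using (zero; suc; _*_; _<_; _∸_; _≤?_; z≤n; s≤s; s<s⁻¹; _≤′_; ≤′-refl; ≤′-step)
open import Data.Nat.Properties
open import Data.Nat.Induction using (<-wellFounded)
open import Data.Nat.Tactic.RingSolver using (solve-∀)
open import Data.Integer as ℤ using (0ℤ; +≤+)
import Data.Integer.Properties as ℤP
import Data.Integer.Tactic.RingSolver as ℤSolver
open import Data.Product using (_,_; proj₁; proj₂)
open import Data.Sum using (_⊎_; inj₁; inj₂)
open import Data.Empty using (⊥)
open import Function using (_∘_; _⇔_; mk⇔; Equivalence)
import Function.Properties.Equivalence as ⇔
open import Induction.WellFounded using (Acc; acc)
open import Relation.Nullary using (¬_; Dec; yes; no; contradiction)
open import Relation.Nullary.Decidable using (map′)
open import Relation.Binary.PropositionalEquality using (refl; sym; trans; cong; cong₂; subst; module ≡-Reasoning)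

open Equivalence using (to; from)

DownwardClosed : (ℕ → Set) → Set
DownwardClosed P = ∀ {m} → P (suc m) → P m

IsFloor : (ℕ → Set) → ℕ → Set
IsFloor P m = P m × ¬ P (suc m)

module _ {P : ℕ → Set} (closed : DownwardClosed P) where

  downwardClosed-≤ : ∀ {m n} → m ≤ n → P n → P m
  downwardClosed-≤ = go ∘ ≤⇒≤′
    where
    go : ∀ {m n} → m ≤′ n → P n → P m
    go ≤′-refl       Pn = Pn
    go (≤′-step m≤n) Pn = go m≤n (closed Pn)

  isFloor-≥ : ∀ {m n} → IsFloor P m → P n → n ≤ m
  isFloor-≥ (_ , ¬Psm) Pn = ≮⇒≥ (λ m<n → ¬Psm (downwardClosed-≤ m<n Pn))

  isFloor-< : ∀ {m n} → IsFloor P m → ¬ P n → m < n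
  isFloor-< (Pm , _) ¬Pn = ≰⇒> (λ n≤m → ¬Pn (downwardClosed-≤ n≤m Pm))

  isFloor-unique : ∀ {m n} → IsFloor P m → IsFloor P n → m ≡ n
  isFloor-unique fm fn = ≤-antisym (isFloor-≥ fn (proj₁ fm)) (isFloor-≥ fm (proj₁ fn))

isFloor-⇔ : ∀ {P P′ : ℕ → Set} {m} → (∀ x → P x ⇔ P′ x) → IsFloor P m → IsFloor P′ m
isFloor-⇔ P⇔P′ (Pm , ¬Psm) = to (P⇔P′ _) Pm , ¬Psm ∘ from (P⇔P′ _)

i≤j⇒i*i≤j*j : ∀ {i j} → 0ℤ ℤ.≤ i → i ℤ.≤ j → i ℤ.* i ℤ.≤ j ℤ.* j
i≤j⇒i*i≤j*j {i} {j} 0≤i i≤j = ℤP.≤-trans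
  (ℤP.*-monoʳ-≤-nonNeg i {{ℤ.nonNegative 0≤i}} i≤j)
  (ℤP.*-monoˡ-≤-nonNeg j {{ℤ.nonNegative (ℤP.≤-trans 0≤i i≤j)}} i≤j)

leSurd-downwardClosed : ∀ {p q} → DownwardClosed (LeSurd p q)
leSurd-downwardClosed {p} {q} {m} Psm with + 2 ℤ.* + m ℤ.- p ℤP.≤? 0ℤ
... | yes d≤0 = inj₁ d≤0
... | no  d≰0 = inj₂ (ℤP.≤-trans (i≤j⇒i*i≤j*j (ℤP.<⇒≤ (ℤP.≰⇒> d≰0)) d≤d′) (d′²≤5q² Psm))
  where
  d  = + 2 ℤ.* + m ℤ.- p
  d′ = + 2 ℤ.* + suc m ℤ.- p
  d′≡d+2 : ∀ M P → + 2 ℤ.* (+ 1 ℤ.+ M) ℤ.- P ≡ (+ 2 ℤ.* M ℤ.- P) ℤ.+ + 2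
  d′≡d+2 = ℤSolver.solve-∀
  d≤d′ : d ℤ.≤ d′
  d≤d′ = subst (d ℤ.≤_) (sym (d′≡d+2 (+ m) p)) (ℤP.i≤i+j d (+ 2))
  d′²≤5q² : LeSurd p q (suc m) → d′ ℤ.* d′ ℤ.≤ + 5 ℤ.* + q ℤ.* + q
  d′²≤5q² (inj₁ d′≤0) = contradiction (ℤP.≤-trans d≤d′ d′≤0) d≰0
  d′²≤5q² (inj₂ d′²≤) = d′²≤

floorBelow-isFloor : ∀ {p q} B → LeSurd p q 0 → ¬ LeSurd p q (suc B) →
                     IsFloor (LeSurd p q) (floorBelow p q B)
floorBelow-isFloor zero P0 ¬P1 = P0 , ¬P1
floorBelow-isFloor {p} {q} (suc B) P0 ¬PB+2 with leSurd? p q (suc B)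
... | yes PB+1 = PB+1 , ¬PB+2
... | no ¬PB+1 = floorBelow-isFloor B P0 ¬PB+1

-- x ≤φ· k encodes x ≤ φk and φ· k ≤ x encodes φk ≤ x.  They are records,
-- rather than abbreviations of inequalities in ℕ, so that x and k can be
-- inferred from them.
infix 4 _≤φ·_ φ·_≤_ _≤φ·?_

record _≤φ·_ (x k : ℕ) : Set where
  constructor ≤φ·⁺
  field ≤φ·⁻ : x * x ≤ x * k + k * k

record φ·_≤_ (k x : ℕ) : Set where
  constructor φ·≤⁺
  field φ·≤⁻ : x * k + k * k ≤ x * x

open _≤φ·_
open φ·_≤_

_≤φ·?_ : ∀ x k → Dec (x ≤φ· k)
x ≤φ·? k = map′ ≤φ·⁺ ≤φ·⁻ (x * x ≤? x * k + k * k)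

≰φ·⇒φ·≤ : ∀ {x k} → ¬ x ≤φ· k → φ· k ≤ x
≰φ·⇒φ·≤ x≰φk = φ·≤⁺ (<⇒≤ (≰⇒> (x≰φk ∘ ≤φ·⁺)))

φ·≰⇒≤φ· : ∀ {x k} → ¬ φ· k ≤ x → x ≤φ· k
φ·≰⇒≤φ· φk≰x = ≤φ·⁺ (<⇒≤ (≰⇒> (φk≰x ∘ φ·≤⁺)))

x*k+k*k-mono : ∀ x k → x * k + k * k ≤ x * suc k + suc k * suc k
x*k+k*k-mono x k = +-mono-≤ (*-monoʳ-≤ x (n≤1+n k)) (*-mono-≤ (n≤1+n k) (n≤1+n k))

≤φ·-monoʳ : ∀ {x k} → x ≤φ· k → x ≤φ· suc k
≤φ·-monoʳ {x} {k} (≤φ·⁺ x≤φk) = ≤φ·⁺ (≤-trans x≤φk (x*k+k*k-mono x k))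

φ·≤-downwardClosed : ∀ {n} → DownwardClosed (φ·_≤ n)
φ·≤-downwardClosed {n} {k} (φ·≤⁺ φsk≤n) = φ·≤⁺ (≤-trans (x*k+k*k-mono n k) φsk≤n)

φ·≤⇒< : ∀ {k x} → 1 ≤ k → φ· k ≤ x → k < x
φ·≤⇒< {k} {x} 1≤k (φ·≤⁺ φk≤x) = ≰⇒> x≰k
  where
  x≰k : ¬ x ≤ k
  x≰k x≤k = <⇒≱ (*-mono-≤ 1≤k 1≤k) (+-cancelˡ-≤ (x * k) (k * k) 0 (begin
    x * k + k * k ≤⟨ φk≤x ⟩
    x * x         ≤⟨ *-monoʳ-≤ x x≤k ⟩
    x * k         ≡⟨ +-identityʳ (x * k) ⟨
    x * k + 0     ∎))
    where open ≤-Reasoning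

φ·1+n≰n : ∀ {n} → ¬ φ· suc n ≤ n
φ·1+n≰n φsn≤n = 1+n≰n (<⇒≤ (φ·≤⇒< (s≤s z≤n) φsn≤n))

+-cancel-≤-⇔ : ∀ {a b c d} → a + d ≡ b + c → (a ≤ b ⇔ c ≤ d)
+-cancel-≤-⇔ {a} {b} {c} {d} a+d≡b+c = mk⇔
  (λ a≤b → +-cancelˡ-≤ b c d (subst (_≤ b + d) a+d≡b+c (+-monoˡ-≤ d a≤b)))
  (λ c≤d → +-cancelʳ-≤ d a b (subst (_≤ b + d) (sym a+d≡b+c) (+-monoʳ-≤ b c≤d)))

-- Q(x + y, x) = −Q(x, y), with both sides moved so that no subtraction occurs.
swap-identity : ∀ x y → (x + y) * (x + y) + x * x ≡ ((x + y) * x + x * x) + (x * y + y * y)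
swap-identity = solve-∀

≤φ·⇔φ·≤+ : ∀ x y → x ≤φ· y ⇔ φ· x ≤ x + y
≤φ·⇔φ·≤+ x y = mk⇔ (φ·≤⁺ ∘ from cancel ∘ ≤φ·⁻) (≤φ·⁺ ∘ to cancel ∘ φ·≤⁻)
  where cancel = +-cancel-≤-⇔ (sym (swap-identity x y))

+≤φ·⇔φ·≤ : ∀ x y → x + y ≤φ· x ⇔ φ· y ≤ x
+≤φ·⇔φ·≤ x y = mk⇔ (φ·≤⁺ ∘ to cancel ∘ ≤φ·⁻) (≤φ·⁺ ∘ from cancel ∘ φ·≤⁻)
  where cancel = +-cancel-≤-⇔ (swap-identity x y)

φ·-irrational : ∀ {k x} → 1 ≤ k → x ≤φ· k → φ· k ≤ x → ⊥
φ·-irrational {k} = descend (<-wellFounded k)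
  where
  descend : ∀ {k x} → Acc _<_ k → 1 ≤ k → x ≤φ· k → φ· k ≤ x → ⊥
  descend {k} (acc smaller) 1≤k x≤φk φk≤x with m≤n⇒∃[o]m+o≡n (φ·≤⇒< 1≤k φk≤x)
  ... | r , refl = descend (smaller (φ·≤⇒< (s≤s z≤n) φ1+r≤k)) (s≤s z≤n) k≤φ1+r φ1+r≤k
    where
    k≤φ1+r = from (≤φ·⇔φ·≤+ k (suc r)) (subst (φ· k ≤_) (sym (+-suc k r)) φk≤x)
    φ1+r≤k = to (+≤φ·⇔φ·≤ k (suc r)) (subst (_≤φ· k) (sym (+-suc k r)) x≤φk)

≤⇔≤-by-gap : ∀ {u v a b} → v ℤ.- u ≡ + 4 ℤ.* (b ℤ.- a) → (u ℤ.≤ v ⇔ a ℤ.≤ b)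
≤⇔≤-by-gap {u} {v} {a} {b} gap = mk⇔
  (λ u≤v → ℤP.0≤i-j⇒j≤i (ℤP.*-cancelˡ-≤-pos 0ℤ (b ℤ.- a) (+ 4)
             (subst (0ℤ ℤ.≤_) gap (ℤP.i≤j⇒0≤j-i u≤v))))
  (λ a≤b → ℤP.0≤i-j⇒j≤i (subst (0ℤ ℤ.≤_) (sym gap)
             (ℤP.*-monoˡ-≤-nonNeg (+ 4) (ℤP.i≤j⇒0≤j-i a≤b))))

pos-≤-⇔ : ∀ {i j m n} → + m ≡ i → + n ≡ j → (i ℤ.≤ j ⇔ m ≤ n)
pos-≤-⇔ refl refl = mk⇔ ℤP.drop‿+≤+ +≤+

φ·0≤ : ∀ n → φ· 0 ≤ n
φ·0≤ n = φ·≤⁺ (≤-trans (≤-reflexive (trans (+-identityʳ (n * 0)) (*-zeroʳ n))) z≤n)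

leSurd⇔≤φ· : ∀ k x → LeSurd (+ k) k x ⇔ x ≤φ· k
leSurd⇔≤φ· k x = mk⇔ toφ (inj₂ ∘ from square⇔)
  where
  gap-identity : ∀ X K → + 5 ℤ.* K ℤ.* K ℤ.- (+ 2 ℤ.* X ℤ.- K) ℤ.* (+ 2 ℤ.* X ℤ.- K)
                         ≡ + 4 ℤ.* ((X ℤ.* K ℤ.+ K ℤ.* K) ℤ.- X ℤ.* X)
  gap-identity = ℤSolver.solve-∀
  square⇔ : (+ 2 ℤ.* + x ℤ.- + k) ℤ.* (+ 2 ℤ.* + x ℤ.- + k) ℤ.≤ + 5 ℤ.* + k ℤ.* + k ⇔ x ≤φ· k
  square⇔ = ⇔.trans (≤⇔≤-by-gap (gap-identity (+ x) (+ k))) (⇔.trans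
              (pos-≤-⇔ (ℤP.pos-* x x) (cong₂ ℤ._+_ (ℤP.pos-* x k) (ℤP.pos-* k k)))
              (mk⇔ ≤φ·⁺ ≤φ·⁻))
  toφ : LeSurd (+ k) k x → x ≤φ· k
  toφ (inj₁ d≤0)    = ≤φ·⁺ (≤-trans (*-monoʳ-≤ x x≤k) (m≤m+n (x * k) (k * k)))
    where
    x≤k : x ≤ k
    x≤k = ≤-trans (m≤m+n x (x + 0)) (to (pos-≤-⇔ (ℤP.pos-* 2 x) refl) (ℤP.i-j≤0⇒i≤j d≤0))
  toφ (inj₂ d²≤5k²) = to square⇔ d²≤5k²

leSurd⇔φ·≤ : ∀ n y → LeSurd (ℤ.- + n) n y ⇔ φ· y ≤ n
leSurd⇔φ·≤ n y = mk⇔ toφ (inj₂ ∘ from square⇔)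
  where
  gap-identity : ∀ Y N → + 5 ℤ.* N ℤ.* N ℤ.- (+ 2 ℤ.* Y ℤ.- ℤ.- N) ℤ.* (+ 2 ℤ.* Y ℤ.- ℤ.- N)
                         ≡ + 4 ℤ.* (N ℤ.* N ℤ.- (N ℤ.* Y ℤ.+ Y ℤ.* Y))
  gap-identity = ℤSolver.solve-∀
  square⇔ : (+ 2 ℤ.* + y ℤ.- ℤ.- + n) ℤ.* (+ 2 ℤ.* + y ℤ.- ℤ.- + n) ℤ.≤ + 5 ℤ.* + n ℤ.* + n ⇔ φ· y ≤ n
  square⇔ = ⇔.trans (≤⇔≤-by-gap (gap-identity (+ y) (+ n))) (⇔.trans
              (pos-≤-⇔ (cong₂ ℤ._+_ (ℤP.pos-* n y) (ℤP.pos-* y y)) (ℤP.pos-* n n))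
              (mk⇔ φ·≤⁺ φ·≤⁻))
  toφ : LeSurd (ℤ.- + n) n y → φ· y ≤ n
  toφ (inj₁ d≤0)    = subst (φ·_≤ n) (sym y≡0) (φ·0≤ n)
    where
    2y+n≤0 : 2 * y + n ≤ 0
    2y+n≤0 = to (pos-≤-⇔ (cong₂ ℤ._+_ (ℤP.pos-* 2 y) (sym (ℤP.neg-involutive (+ n)))) refl) d≤0
    y≡0 : y ≡ 0
    y≡0 = n≤0⇒n≡0 (≤-trans (m≤m+n y (y + 0)) (m+n≤o⇒m≤o (2 * y) 2y+n≤0))
  toφ (inj₂ d²≤5n²) = to square⇔ d²≤5n²

≤φ·-downwardClosed : ∀ {k} → DownwardClosed (_≤φ· k)
≤φ·-downwardClosed {k} {x} = to (leSurd⇔≤φ· k x) ∘ leSurd-downwardClosed {+ k} {k} ∘ from (leSurd⇔≤φ· k (suc x))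

φ·≤-pred : ∀ {k x} → φ· suc k ≤ suc x → φ· k ≤ x
φ·≤-pred {k} φsk≤sx with m≤n⇒∃[o]m+o≡n (<⇒≤ (s<s⁻¹ (φ·≤⇒< (s≤s z≤n) φsk≤sx)))
... | r , refl = to (≤φ·⇔φ·≤+ k r) (≤φ·-downwardClosed (from (≤φ·⇔φ·≤+ (suc k) r) φsk≤sx))

a-isFloor : ∀ k → IsFloor (_≤φ· k) (a k)
a-isFloor k = isFloor-⇔ (leSurd⇔≤φ· k)
  (floorBelow-isFloor (2 * k) (from (leSurd⇔≤φ· k 0) (≤φ·⁺ z≤n)) (¬1+2k≤φk ∘ to (leSurd⇔≤φ· k _)))
  where
  1+2k≡k+[1+k] : ∀ k → suc (2 * k) ≡ k + suc k
  1+2k≡k+[1+k] = solve-∀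
  ¬1+2k≤φk : ¬ suc (2 * k) ≤φ· k
  ¬1+2k≤φk = φ·1+n≰n ∘ to (+≤φ·⇔φ·≤ k (suc k)) ∘ subst (_≤φ· k) (1+2k≡k+[1+k] k)

a-unique : ∀ {k m} → IsFloor (_≤φ· k) m → a k ≡ m
a-unique {k} = isFloor-unique ≤φ·-downwardClosed (a-isFloor k)

a-≥ : ∀ {k x} → x ≤φ· k → x ≤ a k
a-≥ {k} = isFloor-≥ ≤φ·-downwardClosed (a-isFloor k)

floorPhiMinus1-isFloor : ∀ n → IsFloor (φ·_≤ n) (floorPhiMinus1 n)
floorPhiMinus1-isFloor n = isFloor-⇔ (leSurd⇔φ·≤ n)
  (floorBelow-isFloor n (from (leSurd⇔φ·≤ n 0) (φ·0≤ n)) (φ·1+n≰n ∘ to (leSurd⇔φ·≤ n _)))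

floorPhiMinus1-unique : ∀ {n c} → IsFloor (φ·_≤ n) c → floorPhiMinus1 n ≡ c
floorPhiMinus1-unique {n} = isFloor-unique φ·≤-downwardClosed (floorPhiMinus1-isFloor n)

floorPhiMinus1-< : ∀ {n} → 1 ≤ n → floorPhiMinus1 n < n
floorPhiMinus1-< {n} 1≤n =
  isFloor-< {P = φ·_≤ n} φ·≤-downwardClosed (floorPhiMinus1-isFloor n) (λ φn≤n → n≮n n (φ·≤⇒< 1≤n φn≤n))

a-positive : ∀ {k} → 1 ≤ k → 1 ≤ a k
a-positive {k} 1≤k = ≤-trans 1≤k (a-≥ (≤φ·⁺ (m≤m+n (k * k) (k * k))))

a[a[k]]+1≡a[k]+k : ∀ {k} → 1 ≤ k → a (a k) + 1 ≡ a k + k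
a[a[k]]+1≡a[k]+k {suc k} _ = begin
  a m + 1       ≡⟨ cong (_+ 1) (a-unique (m+k≤φm , ¬1+m+k≤φm)) ⟩
  m + k + 1     ≡⟨ +-comm (m + k) 1 ⟩
  suc (m + k)   ≡⟨ +-suc m k ⟨
  m + suc k     ∎
  where
  open ≡-Reasoning
  m = a (suc k)
  m≤φ1+k   = proj₁ (a-isFloor (suc k))
  1+m≰φ1+k = proj₂ (a-isFloor (suc k))
  m+k≤φm : m + k ≤φ· m
  m+k≤φm = from (+≤φ·⇔φ·≤ m k) (φ·≤-pred (≰φ·⇒φ·≤ 1+m≰φ1+k))
  ¬1+m+k≤φm : ¬ suc (m + k) ≤φ· m
  ¬1+m+k≤φm 1+m+k≤φm = φ·-irrational (s≤s z≤n) m≤φ1+k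
    (to (+≤φ·⇔φ·≤ m (suc k)) (subst (_≤φ· m) (sym (+-suc m k)) 1+m+k≤φm))

floorPhiMinus1[a[k]+k]≡a[k] : ∀ {k} → 1 ≤ k → floorPhiMinus1 (a k + k) ≡ a k
floorPhiMinus1[a[k]+k]≡a[k] {suc k} _ =
  floorPhiMinus1-unique (to (≤φ·⇔φ·≤+ m (suc k)) m≤φ1+k , ¬φ1+m≤m+1+k)
  where
  m = a (suc k)
  m≤φ1+k   = proj₁ (a-isFloor (suc k))
  1+m≰φ1+k = proj₂ (a-isFloor (suc k))
  ¬φ1+m≤m+1+k : ¬ φ· suc m ≤ m + suc k
  ¬φ1+m≤m+1+k φ1+m≤m+1+k = 1+m≰φ1+k
    (≤φ·-monoʳ (from (≤φ·⇔φ·≤+ (suc m) k) (subst (φ· suc m ≤_) (+-suc m k) φ1+m≤m+1+k)))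

floorPhiMinus1-split : ∀ {c j} → IsFloor (φ·_≤ (c + j)) c → c + j ≡ a (suc c) ⊎ c + j ≡ a j + j
floorPhiMinus1-split {c} {j} (φc≤c+j , ¬φ1+c≤c+j) with suc (c + j) ≤φ·? suc c
... | no  ¬1+c+j≤φ1+c = inj₁ (sym (a-unique (φ·≰⇒≤φ· ¬φ1+c≤c+j , ¬1+c+j≤φ1+c)))
... | yes 1+c+j≤φ1+c  = inj₂ (cong (_+ j) (sym (a-unique (from (≤φ·⇔φ·≤+ c j) φc≤c+j , ¬1+c≤φj))))
  where
  ¬1+c≤φj : ¬ suc c ≤φ· j
  ¬1+c≤φj = φ·-irrational (s≤s z≤n) 1+c+j≤φ1+c ∘ to (≤φ·⇔φ·≤+ (suc c) j)

a⊎a+id-covers : ∀ {n} → 1 ≤ n → ∃[ k ] 1 ≤ k × (n ≡ a k ⊎ n ≡ a k + k)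
a⊎a+id-covers {n} 1≤n = witness (floorPhiMinus1-split floor)
  where
  c   = floorPhiMinus1 n
  c<n = floorPhiMinus1-< 1≤n
  j   = n ∸ c
  c+j≡n : c + j ≡ n
  c+j≡n = m+[n∸m]≡n (<⇒≤ c<n)
  floor : IsFloor (φ·_≤ (c + j)) c
  floor = subst (λ m → IsFloor (φ·_≤ m) c) (sym c+j≡n) (floorPhiMinus1-isFloor n)
  witness : c + j ≡ a (suc c) ⊎ c + j ≡ a j + j → ∃[ k ] 1 ≤ k × (n ≡ a k ⊎ n ≡ a k + k)
  witness (inj₁ c+j≡a[1+c]) = suc c , s≤s z≤n , inj₁ (trans (sym c+j≡n) c+j≡a[1+c])
  witness (inj₂ c+j≡a[j]+j) = j , m<n⇒0<n∸m c<n , inj₂ (trans (sym c+j≡n) c+j≡a[j]+j)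

a∈R₀₀ : ∀ {k} → 1 ≤ k → R 0 (+ 0) (a k)
a∈R₀₀ {k} 1≤k = k , 1≤k , cong +_ (f₀₀ (a k) k)
  where
  f₀₀ : ∀ m k → m ≡ 1 * m + 0 * k + 0
  f₀₀ = solve-∀

a+id∈R₁₀ : ∀ {k} → 1 ≤ k → R 1 (+ 0) (a k + k)
a+id∈R₁₀ {k} 1≤k = k , 1≤k , cong +_ (f₁₀ (a k) k)
  where
  f₁₀ : ∀ m k → m + k ≡ 1 * m + 1 * k + 0
  f₁₀ = solve-∀

theorem4p1 : (f : ℕ → ℕ)
    → (∀ n → 1 ≤ n → R 0 (+ 0) n → f n ≡ a n + 1)
    → (∀ n → 1 ≤ n → R 1 (+ 0) n → f n ≡ floorPhiMinus1 n)
    → (∀ n → 1 ≤ n → 1 ≤ f n)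
    × (∀ n → 1 ≤ n → f (f n) ≡ n)
    × (∃[ n ] (1 ≤ n × f n ≢ n))
theorem4p1 f f-on-R₀₀ f-on-R₁₀ = positive , involutive , 1 , s≤s z≤n , f1≢1
  where
  f[a[k]]≡a[k]+k : ∀ {k} → 1 ≤ k → f (a k) ≡ a k + k
  f[a[k]]≡a[k]+k 1≤k =
    trans (f-on-R₀₀ _ (a-positive 1≤k) (a∈R₀₀ 1≤k)) (a[a[k]]+1≡a[k]+k 1≤k)
  f[a[k]+k]≡a[k] : ∀ {k} → 1 ≤ k → f (a k + k) ≡ a k
  f[a[k]+k]≡a[k] {k} 1≤k =
    trans (f-on-R₁₀ _ (≤-trans (a-positive 1≤k) (m≤m+n (a k) k)) (a+id∈R₁₀ 1≤k))
          (floorPhiMinus1[a[k]+k]≡a[k] 1≤k)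
  positive : ∀ n → 1 ≤ n → 1 ≤ f n
  positive n 1≤n with a⊎a+id-covers 1≤n
  ... | k , 1≤k , inj₁ refl = subst (1 ≤_) (sym (f[a[k]]≡a[k]+k 1≤k)) (≤-trans 1≤n (m≤m+n (a k) k))
  ... | k , 1≤k , inj₂ refl = subst (1 ≤_) (sym (f[a[k]+k]≡a[k] 1≤k)) (a-positive 1≤k)
  involutive : ∀ n → 1 ≤ n → f (f n) ≡ n
  involutive n 1≤n with a⊎a+id-covers 1≤n
  ... | k , 1≤k , inj₁ refl = trans (cong f (f[a[k]]≡a[k]+k 1≤k)) (f[a[k]+k]≡a[k] 1≤k)
  ... | k , 1≤k , inj₂ refl = trans (cong f (f[a[k]+k]≡a[k] 1≤k)) (f[a[k]]≡a[k]+k 1≤k)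
  f1≢1 : f 1 ≢ 1
  f1≢1 f1≡1 = 1+n≰n (≤-reflexive (trans (sym (f[a[k]]≡a[k]+k {1} (s≤s z≤n))) f1≡1))
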